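{- Let $\sigma$ be a finite relational vocabulary with maximum arity $n$, $A$, $B$ finite $\sigma$-structures, and $n \le k \le k'$. If $A \to^{\mathbb{Z}}_{k'} B$ then $A \to^{\mathbb{Z}}_k B$.
   Context: Structures are identified with universes. For $j\ge n$: $S_j(A)$ is the poset of subsets of $A$ of size at most $j$ (induced substructures), $M_j(A)$ its set of maximal elements; $H_j : S_j(A)^{op}\to\mathbf{Set}$ sends $C$ to the set of homomorphisms $C\to B$, restriction maps $\rho^C_{C'}(h) = h|_{C'}$. A subpresheaf is flasque if its restriction maps are surjective; $P^{\Diamond}$ is the largest flasque subpresheaf of $P$. $\mathbb{Z}^{(X)}$ is the free abelian group on $X$, $\mathbb{Z}^{(f)}(\sum r_ix_i) = \sum r_i f(x_i)$. For a flasque subpresheaf $S$ of $H_j$ and $s\in S(C_0)$, $C_0\in M_j(A)$, $\mathbb{Z}\text{ -test}(S,s)$ holds iff there is $\{\alpha_C\}_{C\in M_j(A)}$, $\alpha_C\in\mathbb{Z}^{(S(C))}$, with $\mathbb{Z}^{(\rho^C_{C\cap C'})}(\alpha_C) = \mathbb{Z}^{(\rho^{C'}_{C\cap C'})}(\alpha_{C'})$ for all $C,C'\in M_j(A)$ and $\alpha_{C_0} = 1\cdot s$. $S^{\Box}(C) = \{s\in S(C):\mathbb{Z}\text{ -test}(S,s)\}$ for $C\in M_j(A)$, $S^{\Box}(C) = S(C)$ otherwise. Set $S^{(0)}_j = H_j^{\Diamond}$ and $S^{(m+1)}_j = ((S^{(m)}_j)^{\Box})^{\Diamond}$; the decreasing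 sequence stabilizes at $S^{(*)}_j$. $A\to^{\mathbb{Z}}_j B$ means $S^{(*)}_j(C)\neq\emptyset$ for some $C\in S_j(A)$. -}

module Defs where

open import Data.Nat using (ℕ; zero; suc; _≤_; _⊔_)
open import Data.Integer using (ℤ; 0ℤ; 1ℤ; _+_)
open import Data.Bool using (Bool; true; false; if_then_else_; T)
open import Data.Fin using (Fin)
open import Data.Fin.Subset using (Subset; _⊆_; _∩_; ∣_∣)
open import Data.Maybe using (Maybe; just; nothing; is-just)
open import Data.Vec using (Vec; []; _∷_; lookup; zipWith; map; foldr)
open import Data.List as List using (List; concatMap)
import Data.Vec.Properties as VecP
import Data.Maybe.Properties as MaybeP
import Data.Fin.Properties as FinP
open import Data.Product using (Σ; _×_; _,_; ∃)
open import Relation.Nullary using (¬_; Dec; yes; no)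
open import Relation.Binary.PropositionalEquality using (_≡_)

record Vocabulary : Set where
  field
    nsym  : ℕ
    arity : Fin nsym → ℕ
open Vocabulary public

maxArity : Vocabulary → ℕ
maxArity σ = foldr (λ _ → ℕ) (λ r m → r ⊔ m) 0 (Data.Vec.tabulate (arity σ))

record Structure (σ : Vocabulary) : Set where
  field
    size : ℕ
    rel  : (R : Fin (nsym σ)) → Vec (Fin size) (arity σ R) → Bool
open Structure public

-- Partial maps from Fin a to Fin b (a partial map determines its domain)

PMap : ℕ → ℕ → Set
PMap a b = Vec (Maybe (Fin b)) a

dom : ∀ {a b} → PMap a b → Subset a
dom = map is-just

restrict : ∀ {a b} → Subset a → PMap a b → PMap a b
restrict = zipWith (λ d m → if d then m else nothing)

_≟ₚ_ : ∀ {a b} (g h : PMap a b) → Dec (g ≡ h)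
_≟ₚ_ = VecP.≡-dec (MaybeP.≡-dec FinP._≟_)

allVecs : ∀ {X : Set} → List X → (n : ℕ) → List (Vec X n)
allVecs xs zero    = List.[ [] ]
allVecs xs (suc n) = concatMap (λ x → List.map (x ∷_) (allVecs xs n)) xs

allPMaps : (a b : ℕ) → List (PMap a b)
allPMaps a b = allVecs (nothing List.∷ List.map just (List.allFin b)) a

module _ {σ : Vocabulary} (A B : Structure σ) where

  -- h : dom h → B is a homomorphism from the induced substructure of A
  -- on dom h to B
  IsHom : PMap (size A) (size B) → Set
  IsHom h = ∀ (R : Fin (nsym σ)) (t : Vec (Fin (size A)) (arity σ R))
              (u : Vec (Fin (size B)) (arity σ R)) →
              T (rel A R t) →
              (∀ i → lookup h (lookup t i) ≡ just (lookup u i)) →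
              T (rel B R u)

  Pred : Set₁
  Pred = PMap (size A) (size B) → Set

  module _ (j : ℕ) where

    InS : Subset (size A) → Set
    InS C = ∣ C ∣ ≤ j

    InM : Subset (size A) → Set
    InM C = InS C × (∀ D → InS D → C ⊆ D → D ≡ C)

    H : Pred
    H h = InS (dom h) × IsHom h

    IsSubpresheaf : Pred → Set
    IsSubpresheaf S =
      (∀ h → S h → H h) ×
      (∀ h D → S h → D ⊆ dom h → S (restrict D h))

    Flasque : Pred → Set
    Flasque S = ∀ C D → InS C → D ⊆ C → ∀ g → S g → dom g ≡ D →
                Σ (PMap (size A) (size B)) λ h →
                  S h × dom h ≡ C × restrict D h ≡ g

    -- P^◇ : the largest flasque subpresheaf of P (union of all flasque
    -- subpresheaves of H_j contained in P)
    ◇ : Pred → Pred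
    ◇ P s = Σ (PMap (size A) (size B) → Bool) λ Q →
              IsSubpresheaf (λ h → T (Q h)) × Flasque (λ h → T (Q h)) ×
              (∀ h → T (Q h) → P h) × T (Q s)

    -- ℤ^(ρ^C_D)(α) evaluated at g, for α a formal ℤ-combination of
    -- partial maps (given by its finitely supported coefficient function)
    push : Subset (size A) → (PMap (size A) (size B) → ℤ) →
           PMap (size A) (size B) → ℤ
    push D α g = List.foldr _+_ 0ℤ
      (List.map (λ h → if Relation.Nullary.does (restrict D h ≟ₚ g)
                         then α h else 0ℤ)
                (allPMaps (size A) (size B)))

    -- ℤ-test(S, s), where C₀ = dom s is maximal
    ZTest : Pred → PMap (size A) (size B) → Set
    ZTest S s =
      Σ (Subset (size A) → PMap (size A) (size B) → ℤ) λ α →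
        -- α_C ∈ ℤ^(S(C)) for C ∈ M_j(A)
        (∀ C → InM C → ∀ h → ¬ (α C h ≡ 0ℤ) → dom h ≡ C × S h) ×
        (∀ C C' → InM C → InM C' → ∀ g →
           push (C ∩ C') (α C) g ≡ push (C ∩ C') (α C') g) ×
        (∀ h → α (dom s) h ≡
               (if Relation.Nullary.does (h ≟ₚ s) then 1ℤ else 0ℤ))

    □ : Pred → Pred
    □ S s = S s × (InM (dom s) → ZTest S s)

    Seq : ℕ → Pred
    Seq zero    = ◇ H
    Seq (suc m) = ◇ (□ (Seq m))

    Lim : Pred
    Lim s = ∀ m → Seq m s

  ZArrow : ℕ → Set
  ZArrow j = Σ (PMap (size A) (size B)) λ s → Lim j s

-- The sequence at level k is dominated by the sequence at level k' on sets of
-- size at most k: by induction on m, S⁽ᵐ⁾_k' restricted to S_k(A) is contained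
-- in S⁽ᵐ⁾_k. Cutting a flasque subpresheaf of H_k' down to S_k(A) keeps it
-- flasque, which handles ◇. For the ℤ-test of s with k-maximal domain, extend
-- s by flasqueness to t with k'-maximal domain, take a ℤ-witness {α'_E} for t,
-- and let α_C be the pushforward along restriction to C of α'_E for some
-- k'-maximal E ⊇ C (chosen to be dom t whenever C ⊆ dom t). Pushing forward
-- to Y and then to X ⊆ Y is pushing forward to X, so compatibility of α'
-- on E ∩ E' yields compatibility of α on C ∩ C' ⊆ E ∩ E'. Finally the empty
-- map lies in S⁽*⁾_k' as soon as S⁽*⁾_k' is nonempty, and it has size 0 ≤ k.
module Submission where

open import Data.Bool using (Bool; true; false; if_then_else_; T; _∧_)
import Data.Bool.Properties as Boolₚ
open import Data.Empty using (⊥-elim)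
open import Data.Fin using (Fin; zero; suc)
import Data.Fin.Properties as Finₚ
open import Data.Fin.Subset using (Subset; _⊆_; _⊂_; _∩_; ∣_∣; ⊥)
open import Data.Fin.Subset.Properties
  using (_∈?_; _⊆?_; _⊂?_; ⊆-refl; ⊆-trans; ⊆-antisym; ⊆-min; p⊂q⇒p⊆q; p⊂q⇒∣p∣<∣q∣;
         ∣p∣≤n; ∣⊥∣≡0; p∩q⊆p; p∩q⊆q; x∈p∩q⁺; ∣p∩q∣≤∣p∣; ∣p∩q∣≤∣q∣; anySubset?)
open import Data.Integer using (ℤ; 0ℤ; 1ℤ; _+_) renaming (_≟_ to _≟ℤ_)
import Data.Integer.Properties as ℤₚ
open import Data.List using (List; []; _∷_; _++_; foldr; map; concatMap; allFin)
import Data.List.Properties as Listₚ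
open import Data.Maybe using (just; nothing)
import Data.Maybe.Properties as Maybeₚ
open import Data.Nat using (ℕ; zero; suc; _≤_; z≤n; _≤?_; _≤ᵇ_) renaming (_+_ to _+ℕ_)
import Data.Nat.Properties as ℕₚ
open import Data.Product using (∃; _×_; _,_; proj₁; proj₂)
open import Data.Sum using (_⊎_; inj₁; inj₂)
open import Data.Vec using (Vec)
import Data.Vec.Properties as Vecₚ
open import Function using (_∘_; id)
open import Function.Bundles using (Equivalence; mk⇔)
open import Relation.Binary.Definitions using (DecidableEquality)
open import Relation.Binary.PropositionalEquality
open import Relation.Nullary using (¬_; Dec; yes; no; does)
open import Relation.Nullary.Decidable using (_×-dec_; dec-true; dec-false; does-⇔; decidable-stable)
open import Algebra.Properties.CommutativeSemigroup ℤₚ.+-commutativeSemigroup using (interchange)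

open import Defs

module _ {X : Set} where

  ∑ : List X → (X → ℤ) → ℤ
  ∑ xs f = foldr _+_ 0ℤ (map f xs)

  ∑-cong : ∀ xs {f g : X → ℤ} → (∀ x → f x ≡ g x) → ∑ xs f ≡ ∑ xs g
  ∑-cong []       f≗g = refl
  ∑-cong (x ∷ xs) f≗g = cong₂ _+_ (f≗g x) (∑-cong xs f≗g)

  ∑-zero : ∀ xs → ∑ xs (λ _ → 0ℤ) ≡ 0ℤ
  ∑-zero []       = refl
  ∑-zero (x ∷ xs) = trans (ℤₚ.+-identityˡ _) (∑-zero xs)

  ∑-+ : ∀ xs (f g : X → ℤ) → ∑ xs (λ x → f x + g x) ≡ ∑ xs f + ∑ xs g
  ∑-+ []       f g = refl
  ∑-+ (x ∷ xs) f g = trans (cong (f x + g x +_) (∑-+ xs f g)) (interchange (f x) (g x) _ _)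

  ∑-++ : ∀ xs ys (f : X → ℤ) → ∑ (xs ++ ys) f ≡ ∑ xs f + ∑ ys f
  ∑-++ []       ys f = sym (ℤₚ.+-identityˡ _)
  ∑-++ (x ∷ xs) ys f = trans (cong (f x +_) (∑-++ xs ys f)) (sym (ℤₚ.+-assoc (f x) _ _))

  ∑≢0⇒∃≢0 : ∀ xs (f : X → ℤ) → ∑ xs f ≢ 0ℤ → ∃ λ x → f x ≢ 0ℤ
  ∑≢0⇒∃≢0 []       f ∑≢0 = ⊥-elim (∑≢0 refl)
  ∑≢0⇒∃≢0 (x ∷ xs) f ∑≢0 with f x ≟ℤ 0ℤ
  ... | no  fx≢0 = x , fx≢0
  ... | yes fx≡0 = ∑≢0⇒∃≢0 xs f (λ ∑xs≡0 → ∑≢0 (cong₂ _+_ fx≡0 ∑xs≡0))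

∑-map : ∀ {X Y : Set} (g : X → Y) xs (f : Y → ℤ) → ∑ (map g xs) f ≡ ∑ xs (f ∘ g)
∑-map g xs f = cong (foldr _+_ 0ℤ) (sym (Listₚ.map-∘ xs))

∑-concatMap : ∀ {X Y : Set} (g : X → List Y) xs (f : Y → ℤ) →
              ∑ (concatMap g xs) f ≡ ∑ xs (λ x → ∑ (g x) f)
∑-concatMap g []       f = refl
∑-concatMap g (x ∷ xs) f = trans (∑-++ (g x) (concatMap g xs) f) (cong (∑ (g x) f +_) (∑-concatMap g xs f))

∑-comm : ∀ {X Y : Set} xs ys (f : X → Y → ℤ) →
         ∑ xs (λ x → ∑ ys (f x)) ≡ ∑ ys (λ y → ∑ xs (λ x → f x y))
∑-comm []       ys f = sym (∑-zero ys)
∑-comm (x ∷ xs) ys f = trans (cong (∑ ys (f x) +_) (∑-comm xs ys f)) (sym (∑-+ ys (f x) _))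

infixr 7 [_]·_

[_]·_ : Bool → ℤ → ℤ
[ b ]· z = if b then z else 0ℤ

[]·-comm : ∀ a b z → [ a ]· [ b ]· z ≡ [ b ]· [ a ]· z
[]·-comm true  true  z = refl
[]·-comm true  false z = refl
[]·-comm false true  z = refl
[]·-comm false false z = refl

[]·-∑ : ∀ {X : Set} b xs (f : X → ℤ) → [ b ]· ∑ xs f ≡ ∑ xs (λ x → [ b ]· f x)
[]·-∑ true  xs f = refl
[]·-∑ false xs f = sym (∑-zero xs)

[]·≢0 : ∀ {P : Set} (p? : Dec P) z → [ does p? ]· z ≢ 0ℤ → P × z ≢ 0ℤ
[]·≢0 (yes p) z z≢0 = p , z≢0
[]·≢0 (no ¬p) z 0≢0 = ⊥-elim (0≢0 refl)

does-sym : ∀ {X : Set} (_≟_ : DecidableEquality X) x y → does (x ≟ y) ≡ does (y ≟ x)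
does-sym _≟_ x y = does-⇔ (mk⇔ sym sym) (x ≟ y) (y ≟ x)

-- The sifting property of the Kronecker delta: xs lists every element exactly once.
record Sifts {X : Set} (_≟_ : DecidableEquality X) (xs : List X) : Set where
  field
    sift : ∀ p (f : X → ℤ) → ∑ xs (λ x → [ does (p ≟ x) ]· f x) ≡ f p
open Sifts

sifts-∷-map : ∀ {X Y : Set} {_≟X_ : DecidableEquality X} (_≟Y_ : DecidableEquality Y) {xs}
              (z : Y) (inj : X → Y) → (∀ {x x'} → inj x ≡ inj x' → x ≡ x') →
              (∀ x → z ≢ inj x) → (∀ y → y ≡ z ⊎ ∃ λ x → y ≡ inj x) →
              Sifts _≟X_ xs → Sifts _≟Y_ (z ∷ map inj xs)
sift (sifts-∷-map {_≟X_ = _≟X_} _≟Y_ {xs} z inj inj-injective z∉image covers sifts) p f with covers p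
... | inj₁ refl = begin
  [ does (z ≟Y z) ]· f z + ∑ (map inj xs) (λ y → [ does (z ≟Y y) ]· f y)
    ≡⟨ cong₂ _+_ (cong ([_]· f z) (dec-true (z ≟Y z) refl)) (∑-map inj xs _) ⟩
  f z + ∑ xs (λ x → [ does (z ≟Y inj x) ]· f (inj x))
    ≡⟨ cong (f z +_) (∑-cong xs (λ x → cong ([_]· f (inj x)) (dec-false (z ≟Y inj x) (z∉image x)))) ⟩
  f z + ∑ xs (λ _ → 0ℤ)
    ≡⟨ cong (f z +_) (∑-zero xs) ⟩
  f z + 0ℤ
    ≡⟨ ℤₚ.+-identityʳ (f z) ⟩
  f z ∎
  where open ≡-Reasoning
... | inj₂ (q , refl) = begin
  [ does (inj q ≟Y z) ]· f z + ∑ (map inj xs) (λ y → [ does (inj q ≟Y y) ]· f y)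
    ≡⟨ cong₂ _+_ (cong ([_]· f z) (dec-false (inj q ≟Y z) (z∉image q ∘ sym))) (∑-map inj xs _) ⟩
  0ℤ + ∑ xs (λ x → [ does (inj q ≟Y inj x) ]· f (inj x))
    ≡⟨ ℤₚ.+-identityˡ _ ⟩
  ∑ xs (λ x → [ does (inj q ≟Y inj x) ]· f (inj x))
    ≡⟨ ∑-cong xs (λ x → cong ([_]· f (inj x)) (does-⇔ (mk⇔ inj-injective (cong inj)) (inj q ≟Y inj x) (q ≟X x))) ⟩
  ∑ xs (λ x → [ does (q ≟X x) ]· f (inj x))
    ≡⟨ sift sifts q (f ∘ inj) ⟩
  f (inj q) ∎
  where open ≡-Reasoning

sifts-allFin : ∀ n → Sifts Finₚ._≟_ (allFin n)
sift (sifts-allFin zero) ()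
sifts-allFin (suc n) = subst (Sifts Finₚ._≟_) (cong (zero ∷_) (Listₚ.map-tabulate id suc))
  (sifts-∷-map Finₚ._≟_ zero suc Finₚ.suc-injective (λ _ ()) covers (sifts-allFin n))
  where
  covers : ∀ (i : Fin (suc n)) → i ≡ zero ⊎ ∃ λ j → i ≡ suc j
  covers zero    = inj₁ refl
  covers (suc j) = inj₂ (j , refl)

sifts-maybe : ∀ {X : Set} (_≟_ : DecidableEquality X) {xs} → Sifts _≟_ xs →
              Sifts (Maybeₚ.≡-dec _≟_) (nothing ∷ map just xs)
sifts-maybe _≟_ = sifts-∷-map (Maybeₚ.≡-dec _≟_) nothing just Maybeₚ.just-injective (λ _ ()) covers
  where
  covers : ∀ y → y ≡ nothing ⊎ ∃ λ x → y ≡ just x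
  covers nothing  = inj₁ refl
  covers (just x) = inj₂ (x , refl)

sifts-allVecs : ∀ {X : Set} (_≟_ : DecidableEquality X) {xs} → Sifts _≟_ xs →
                ∀ n → Sifts (Vecₚ.≡-dec _≟_) (allVecs xs n)
sift (sifts-allVecs _≟_ sifts zero) Vec.[] f = ℤₚ.+-identityʳ (f Vec.[])
sift (sifts-allVecs _≟_ {xs} sifts (suc n)) (p Vec.∷ ps) f = begin
  ∑ (concatMap (λ x → map (x Vec.∷_) (allVecs xs n)) xs) (λ v → [ does ((p Vec.∷ ps) ≟ᵥ v) ]· f v)
    ≡⟨ ∑-concatMap _ xs _ ⟩
  ∑ xs (λ x → ∑ (map (x Vec.∷_) (allVecs xs n)) (λ v → [ does ((p Vec.∷ ps) ≟ᵥ v) ]· f v))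
    ≡⟨ ∑-cong xs (λ x → trans (∑-map (x Vec.∷_) (allVecs xs n) _) (row x)) ⟩
  ∑ xs (λ x → [ does (p ≟ x) ]· f (p Vec.∷ ps))
    ≡⟨ sift sifts p (λ _ → f (p Vec.∷ ps)) ⟩
  f (p Vec.∷ ps) ∎
  where
  open ≡-Reasoning
  _≟ᵥ_ : ∀ {m} → DecidableEquality (Vec _ m)
  _≟ᵥ_ = Vecₚ.≡-dec _≟_
  row : ∀ x → ∑ (allVecs xs n) (λ v → [ does ((p Vec.∷ ps) ≟ᵥ (x Vec.∷ v)) ]· f (x Vec.∷ v))
            ≡ [ does (p ≟ x) ]· f (p Vec.∷ ps)
  row x with p ≟ x
  ... | yes refl = sift (sifts-allVecs _≟_ sifts n) ps (f ∘ (p Vec.∷_))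
  ... | no  _    = ∑-zero (allVecs xs n)

sifts-allPMaps : ∀ a b → Sifts (_≟ₚ_ {a} {b}) (allPMaps a b)
sifts-allPMaps a b = sifts-allVecs _ (sifts-maybe Finₚ._≟_ (sifts-allFin b)) a

dom-restrict : ∀ {a b} (D : Subset a) (h : PMap a b) → dom (restrict D h) ≡ D ∩ dom h
dom-restrict Vec.[]           Vec.[]      = refl
dom-restrict (true  Vec.∷ D) (m Vec.∷ h) = cong (_ Vec.∷_) (dom-restrict D h)
dom-restrict (false Vec.∷ D) (m Vec.∷ h) = cong (false Vec.∷_) (dom-restrict D h)

restrict-restrict : ∀ {a b} (X Y : Subset a) (h : PMap a b) →
                    restrict X (restrict Y h) ≡ restrict (X ∩ Y) h
restrict-restrict Vec.[]           Vec.[]      Vec.[]      = refl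
restrict-restrict (true  Vec.∷ X) (y Vec.∷ Y) (m Vec.∷ h) = cong (_ Vec.∷_) (restrict-restrict X Y h)
restrict-restrict (false Vec.∷ X) (y Vec.∷ Y) (m Vec.∷ h) = cong (nothing Vec.∷_) (restrict-restrict X Y h)

∣dom-restrict∣≤ : ∀ {a b} (D : Subset a) (h : PMap a b) → ∣ dom (restrict D h) ∣ ≤ ∣ dom h ∣
∣dom-restrict∣≤ D h = subst (λ E → ∣ E ∣ ≤ ∣ dom h ∣) (sym (dom-restrict D h)) (∣p∩q∣≤∣q∣ D (dom h))

p⊆q⇒p∩q≡p : ∀ {n} {p q : Subset n} → p ⊆ q → p ∩ q ≡ p
p⊆q⇒p∩q≡p {p = p} {q} p⊆q = ⊆-antisym (p∩q⊆p p q) (λ x∈p → x∈p∩q⁺ (x∈p , p⊆q x∈p))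

⊆-∩ : ∀ {n} {p q r : Subset n} → p ⊆ q → p ⊆ r → p ⊆ q ∩ r
⊆-∩ p⊆q p⊆r x∈p = x∈p∩q⁺ (p⊆q x∈p , p⊆r x∈p)

⊆∧⊄⇒⊇ : ∀ {n} {p q : Subset n} → p ⊆ q → ¬ p ⊂ q → q ⊆ p
⊆∧⊄⇒⊇ {p = p} p⊆q p⊄q {x} x∈q = decidable-stable (x ∈? p) (λ x∉p → p⊄q (p⊆q , x , x∈q , x∉p))

module _ {a b : ℕ} where

  -- Defs.push A B j unfolds to this; it depends on neither the structures nor j.
  pushforward : Subset a → (PMap a b → ℤ) → PMap a b → ℤ
  pushforward D α g = ∑ (allPMaps a b) (λ h → [ does (restrict D h ≟ₚ g) ]· α h)

  δ : PMap a b → PMap a b → ℤ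
  δ s h = [ does (h ≟ₚ s) ]· 1ℤ

  pushforward-cong : ∀ D {α β : PMap a b → ℤ} → (∀ h → α h ≡ β h) →
                     ∀ g → pushforward D α g ≡ pushforward D β g
  pushforward-cong D α≗β g = ∑-cong (allPMaps a b) (λ h → cong [ _ ]·_ (α≗β h))

  pushforward-∘ : ∀ {X Y : Subset a} (β : PMap a b → ℤ) → X ⊆ Y →
                  ∀ g → pushforward X (pushforward Y β) g ≡ pushforward X β g
  pushforward-∘ {X} {Y} β X⊆Y g = begin
    ∑ all (λ g' → [ does (restrict X g' ≟ₚ g) ]· ∑ all (λ h → [ does (restrict Y h ≟ₚ g') ]· β h))
      ≡⟨ ∑-cong all (λ g' → []·-∑ _ all _) ⟩
    ∑ all (λ g' → ∑ all (λ h → [ does (restrict X g' ≟ₚ g) ]· [ does (restrict Y h ≟ₚ g') ]· β h))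
      ≡⟨ ∑-comm all all _ ⟩
    ∑ all (λ h → ∑ all (λ g' → [ does (restrict X g' ≟ₚ g) ]· [ does (restrict Y h ≟ₚ g') ]· β h))
      ≡⟨ ∑-cong all (λ h → ∑-cong all (λ g' →
           []·-comm (does (restrict X g' ≟ₚ g)) (does (restrict Y h ≟ₚ g')) (β h))) ⟩
    ∑ all (λ h → ∑ all (λ g' → [ does (restrict Y h ≟ₚ g') ]· [ does (restrict X g' ≟ₚ g) ]· β h))
      ≡⟨ ∑-cong all (λ h → sift (sifts-allPMaps a b) (restrict Y h) (λ g' → [ does (restrict X g' ≟ₚ g) ]· β h)) ⟩
    ∑ all (λ h → [ does (restrict X (restrict Y h) ≟ₚ g) ]· β h)
      ≡⟨ ∑-cong all (λ h → cong (λ h' → [ does (h' ≟ₚ g) ]· β h) (restrict-⊆ h)) ⟩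
    ∑ all (λ h → [ does (restrict X h ≟ₚ g) ]· β h) ∎
    where
    open ≡-Reasoning
    all = allPMaps a b
    restrict-⊆ : ∀ h → restrict X (restrict Y h) ≡ restrict X h
    restrict-⊆ h = trans (restrict-restrict X Y h) (cong (λ Z → restrict Z h) (p⊆q⇒p∩q≡p X⊆Y))

  pushforward-δ : ∀ D t g → pushforward D (δ t) g ≡ δ (restrict D t) g
  pushforward-δ D t g = begin
    ∑ all (λ h → [ does (restrict D h ≟ₚ g) ]· [ does (h ≟ₚ t) ]· 1ℤ)
      ≡⟨ ∑-cong all (λ h → trans ([]·-comm (does (restrict D h ≟ₚ g)) (does (h ≟ₚ t)) 1ℤ)
                                 (cong (λ c → [ c ]· _) (does-sym _≟ₚ_ h t))) ⟩
    ∑ all (λ h → [ does (t ≟ₚ h) ]· [ does (restrict D h ≟ₚ g) ]· 1ℤ)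
      ≡⟨ sift (sifts-allPMaps a b) t (λ h → [ does (restrict D h ≟ₚ g) ]· 1ℤ) ⟩
    [ does (restrict D t ≟ₚ g) ]· 1ℤ
      ≡⟨ cong ([_]· 1ℤ) (does-sym _≟ₚ_ (restrict D t) g) ⟩
    [ does (g ≟ₚ restrict D t) ]· 1ℤ ∎
    where
    open ≡-Reasoning
    all = allPMaps a b

  pushforward-support : ∀ D (α : PMap a b → ℤ) g → pushforward D α g ≢ 0ℤ →
                        ∃ λ h → restrict D h ≡ g × α h ≢ 0ℤ
  pushforward-support D α g push≢0 =
    let h , term≢0 = ∑≢0⇒∃≢0 (allPMaps a b) _ push≢0
    in  h , []·≢0 (restrict D h ≟ₚ g) (α h) term≢0

module _ {σ : Vocabulary} (A B : Structure σ) where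

  PartialMap : Set
  PartialMap = PMap (size A) (size B)

  extendToMaximal : ∀ j C → InS A B j C → ∃ λ E → C ⊆ E × InM A B j E
  extendToMaximal j C = grow (size A) C (ℕₚ.m≤n+m (size A) ∣ C ∣)
    where
    grow : ∀ fuel C → size A ≤ ∣ C ∣ +ℕ fuel → InS A B j C → ∃ λ E → C ⊆ E × InM A B j E
    grow fuel C bound C∈S with anySubset? (λ D → C ⊂? D ×-dec ∣ D ∣ ≤? j)
    ... | no ∄D = C , ⊆-refl , C∈S , λ D D∈S C⊆D → ⊆-antisym (⊆∧⊄⇒⊇ C⊆D (λ C⊂D → ∄D (D , C⊂D , D∈S))) C⊆D
    grow zero C bound _ | yes (D , C⊂D , _) =
      ⊥-elim (ℕₚ.<⇒≱ (p⊂q⇒∣p∣<∣q∣ C⊂D) (ℕₚ.≤-trans (∣p∣≤n D) (subst (size A ≤_) (ℕₚ.+-identityʳ _) bound)))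
    grow (suc fuel) C bound _ | yes (D , C⊂D , D∈S) =
      let E , D⊆E , E∈M = grow fuel D bound′ D∈S in E , ⊆-trans (p⊂q⇒p⊆q C⊂D) D⊆E , E∈M
      where
      bound′ : size A ≤ ∣ D ∣ +ℕ fuel
      bound′ = ℕₚ.≤-trans bound (ℕₚ.≤-trans (ℕₚ.≤-reflexive (ℕₚ.+-suc ∣ C ∣ fuel))
                                             (ℕₚ.+-monoˡ-≤ fuel (p⊂q⇒∣p∣<∣q∣ C⊂D)))

  RestrictionClosed : Pred A B → Set
  RestrictionClosed S = ∀ g D → S g → D ⊆ dom g → S (restrict D g)

  ◇-restrictionClosed : ∀ j P → RestrictionClosed (◇ A B j P)
  ◇-restrictionClosed j P g D (Q , (Q⊆H , Q-closed) , Q-flasque , Q⊆P , Qg) D⊆g =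
    Q , (Q⊆H , Q-closed) , Q-flasque , Q⊆P , Q-closed g D Qg D⊆g

  Seq-restrictionClosed : ∀ j m → RestrictionClosed (Seq A B j m)
  Seq-restrictionClosed j zero    = ◇-restrictionClosed j (H A B j)
  Seq-restrictionClosed j (suc m) = ◇-restrictionClosed j (□ A B j (Seq A B j m))

  module _ {k k' : ℕ} (k≤k' : k ≤ k') where

    ◇-lower : ∀ {P : Pred A B} (Q : PartialMap → Bool) →
              IsSubpresheaf A B k' (T ∘ Q) → Flasque A B k' (T ∘ Q) →
              (∀ h → T (Q h) → InS A B k (dom h) → P h) →
              ∀ s → T (Q s) → InS A B k (dom s) → ◇ A B k P s
    ◇-lower Q (Q⊆H , Q-closed) Q-flasque Qₖ⊆P s Qs s∈S =
      Qₖ , (Qₖ⊆H , Qₖ-closed) , Qₖ-flasque , (λ h Qₖh → let h∈S , Qh = split h Qₖh in Qₖ⊆P h Qh h∈S) ,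
      join s s∈S Qs
      where
      Qₖ : PartialMap → Bool
      Qₖ h = (∣ dom h ∣ ≤ᵇ k) ∧ Q h
      split : ∀ h → T (Qₖ h) → InS A B k (dom h) × T (Q h)
      split h Qₖh = let small , Qh = Equivalence.to Boolₚ.T-∧ Qₖh in ℕₚ.≤ᵇ⇒≤ _ k small , Qh
      join : ∀ h → InS A B k (dom h) → T (Q h) → T (Qₖ h)
      join h h∈S Qh = Equivalence.from Boolₚ.T-∧ (ℕₚ.≤⇒≤ᵇ h∈S , Qh)
      Qₖ⊆H : ∀ h → T (Qₖ h) → H A B k h
      Qₖ⊆H h Qₖh = let h∈S , Qh = split h Qₖh in h∈S , proj₂ (Q⊆H h Qh)
      Qₖ-closed : ∀ h D → T (Qₖ h) → D ⊆ dom h → T (Qₖ (restrict D h))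
      Qₖ-closed h D Qₖh D⊆h = let h∈S , Qh = split h Qₖh in
        join _ (ℕₚ.≤-trans (∣dom-restrict∣≤ D h) h∈S) (Q-closed h D Qh D⊆h)
      Qₖ-flasque : Flasque A B k (T ∘ Qₖ)
      Qₖ-flasque C D C∈S D⊆C g Qₖg g-dom =
        let h , Qh , h-dom , h↾D = Q-flasque C D (ℕₚ.≤-trans C∈S k≤k') D⊆C g (proj₂ (split g Qₖg)) g-dom
        in  h , join h (subst (λ E → ∣ E ∣ ≤ k) (sym h-dom) C∈S) Qh , h-dom , h↾D

    ZTest-lower : (S′ S : Pred A B) → RestrictionClosed S′ →
                  (∀ g → S′ g → InS A B k (dom g) → S g) →
                  ∀ t → InM A B k' (dom t) → ZTest A B k' S′ t →
                  ∀ h → dom h ⊆ dom t → restrict (dom h) t ≡ h → ZTest A B k S h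
    ZTest-lower S′ S S′-closed S′⇒S t t-maximal (α′ , α′-support , α′-compatible , α′-at-t) h h⊆t t↾h =
      α , support , compatible , at-h
      where
      cover : Subset (size A) → Subset (size A)
      cover C with C ⊆? dom t | ∣ C ∣ ≤? k'
      ... | yes _ | _       = dom t
      ... | no  _ | yes C∈S = proj₁ (extendToMaximal k' C C∈S)
      ... | no  _ | no  _   = C

      cover-spec : ∀ C → InS A B k C → C ⊆ cover C × InM A B k' (cover C)
      cover-spec C C∈S with C ⊆? dom t | ∣ C ∣ ≤? k'
      ... | yes C⊆t | _        = C⊆t , t-maximal
      ... | no  _   | yes C∈S′ = proj₂ (extendToMaximal k' C C∈S′)
      ... | no  _   | no  C∉S′ = ⊥-elim (C∉S′ (ℕₚ.≤-trans C∈S k≤k'))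

      cover-dom : cover (dom h) ≡ dom t
      cover-dom with dom h ⊆? dom t
      ... | yes _    = refl
      ... | no  h⊈t = ⊥-elim (h⊈t h⊆t)

      α : Subset (size A) → PartialMap → ℤ
      α C = pushforward C (α′ (cover C))

      support : ∀ C → InM A B k C → ∀ g → α C g ≢ 0ℤ → dom g ≡ C × S g
      support C (C∈S , _) g αCg≢0
        with g′ , g′↾C , α′g′≢0 ← pushforward-support C (α′ (cover C)) g αCg≢0
        with C⊆E , E∈M ← cover-spec C C∈S
        with g′-dom , S′g′ ← α′-support (cover C) E∈M g′ α′g′≢0
        = g-dom , S′⇒S g S′g (subst (λ D → ∣ D ∣ ≤ k) (sym g-dom) C∈S)
        where
        g-dom : dom g ≡ C
        g-dom = begin
          dom g               ≡⟨ cong dom g′↾C ⟨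
          dom (restrict C g′) ≡⟨ dom-restrict C g′ ⟩
          C ∩ dom g′          ≡⟨ cong (C ∩_) g′-dom ⟩
          C ∩ cover C         ≡⟨ p⊆q⇒p∩q≡p C⊆E ⟩
          C                   ∎
          where open ≡-Reasoning
        S′g : S′ g
        S′g = subst S′ g′↾C (S′-closed g′ C S′g′ (subst (C ⊆_) (sym g′-dom) C⊆E))

      compatible : ∀ C C″ → InM A B k C → InM A B k C″ → ∀ g →
                   push A B k (C ∩ C″) (α C) g ≡ push A B k (C ∩ C″) (α C″) g
      compatible C C″ (C∈S , _) (C″∈S , _) g
        with C⊆E , E∈M ← cover-spec C C∈S
        with C″⊆E″ , E″∈M ← cover-spec C″ C″∈S = begin
        pushforward X (pushforward C (α′ E)) g   ≡⟨ pushforward-∘ (α′ E) (p∩q⊆p C C″) g ⟩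
        pushforward X (α′ E) g                   ≡⟨ pushforward-∘ (α′ E) X⊆Y g ⟨
        pushforward X (pushforward Y (α′ E)) g   ≡⟨ pushforward-cong X (α′-compatible E E″ E∈M E″∈M) g ⟩
        pushforward X (pushforward Y (α′ E″)) g  ≡⟨ pushforward-∘ (α′ E″) X⊆Y g ⟩
        pushforward X (α′ E″) g                  ≡⟨ pushforward-∘ (α′ E″) (p∩q⊆q C C″) g ⟨
        pushforward X (pushforward C″ (α′ E″)) g ∎
        where
        open ≡-Reasoning
        X = C ∩ C″
        E = cover C
        E″ = cover C″
        Y = E ∩ E″
        X⊆Y : X ⊆ Y
        X⊆Y = ⊆-∩ (⊆-trans (p∩q⊆p C C″) C⊆E) (⊆-trans (p∩q⊆q C C″) C″⊆E″)

      at-h : ∀ g → α (dom h) g ≡ δ h g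
      at-h g = begin
        pushforward (dom h) (α′ (cover (dom h))) g ≡⟨ cong (λ E → pushforward (dom h) (α′ E) g) cover-dom ⟩
        pushforward (dom h) (α′ (dom t)) g         ≡⟨ pushforward-cong (dom h) α′-at-t g ⟩
        pushforward (dom h) (δ t) g                ≡⟨ pushforward-δ (dom h) t g ⟩
        δ (restrict (dom h) t) g                   ≡⟨ cong (λ h′ → δ h′ g) t↾h ⟩
        δ h g                                      ∎
        where open ≡-Reasoning

    □-lower : (S′ S : Pred A B) → RestrictionClosed S′ →
              (∀ g → S′ g → InS A B k (dom g) → S g) →
              (Q : PartialMap → Bool) → Flasque A B k' (T ∘ Q) → (∀ h → T (Q h) → □ A B k' S′ h) →
              ∀ h → T (Q h) → InS A B k (dom h) → □ A B k S h
    □-lower S′ S S′-closed S′⇒S Q Q-flasque Q⊆□ h Qh h∈S = S′⇒S h (proj₁ (Q⊆□ h Qh)) h∈S , ztest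
      where
      ztest : InM A B k (dom h) → ZTest A B k S h
      ztest _
        with E , h⊆E , E∈M ← extendToMaximal k' (dom h) (ℕₚ.≤-trans h∈S k≤k')
        with t , Qt , refl , t↾h ← Q-flasque E (dom h) (proj₁ E∈M) h⊆E h Qh refl
        = ZTest-lower S′ S S′-closed S′⇒S t E∈M (proj₂ (Q⊆□ t Qt) E∈M) h h⊆E t↾h

    Seq-lower : ∀ m h → Seq A B k' m h → InS A B k (dom h) → Seq A B k m h
    Seq-lower zero    h (Q , Q-sub , Q-flasque , Q⊆H , Qh) =
      ◇-lower Q Q-sub Q-flasque (λ g Qg g∈S → g∈S , proj₂ (Q⊆H g Qg)) h Qh
    Seq-lower (suc m) h (Q , Q-sub , Q-flasque , Q⊆□ , Qh) =
      ◇-lower Q Q-sub Q-flasque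
        (□-lower (Seq A B k' m) (Seq A B k m) (Seq-restrictionClosed k' m) (Seq-lower m) Q Q-flasque Q⊆□)
        h Qh

    ZArrow-lower : ZArrow A B k' → ZArrow A B k
    ZArrow-lower (s , s∈S*) =
      restrict ⊥ s , λ m → Seq-lower m _ (Seq-restrictionClosed k' m s ⊥ (s∈S* m) (⊆-min _)) empty-small
      where
      empty-small : ∣ dom (restrict ⊥ s) ∣ ≤ k
      empty-small = subst (λ E → ∣ E ∣ ≤ k) (sym (dom-restrict ⊥ s))
                      (ℕₚ.≤-trans (∣p∩q∣≤∣p∣ ⊥ (dom s)) (subst (_≤ k) (sym (∣⊥∣≡0 (size A))) z≤n))

proposition18p1 : (σ : Vocabulary) (A B : Structure σ) (k k' : ℕ) →
    maxArity σ ≤ k → k ≤ k' → ZArrow A B k' → ZArrow A B k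
proposition18p1 σ A B k k' _ k≤k' = ZArrow-lower A B k≤k'
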